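{- Let $X\subseteq B^h$, $G=Q_h(X)$, and let $u\in V(G)$ have degree $h$. Then $|N^u(v)|\ge 2$ for every $v\in V(G)\setminus N[u]$.
   Context: $B=\{0,1\}$, $B^h$ binary words of length $h$, $Q_h$ the hypercube on $B^h$ (adjacent iff Hamming distance $1$). $u\le v$ means $u_i\le v_i$ for all $i$. For $X\subseteq B^h$, the daisy cube $Q_h(X)$ is the subgraph of $Q_h$ induced by $\{v: v\le x\text{ for some }x\in X\}$. $N(u)$ is the set of neighbours of $u$, $N[u]=N(u)\cup\{u\}$, and $N^u(v)=\{z\in N(v): d_G(u,z)=d_G(u,v)-1\}$. -}

module Defs where

open import Data.Bool using (Bool; true; false; not)
open import Data.Bool.Properties using (_≟_)
import Data.Bool as Bool
import Data.Bool.Properties as BoolP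
open import Data.Nat using (ℕ; zero; suc; _<_; _∸_)
import Data.Nat.Properties as ℕP
open import Data.Vec using (Vec; []; _∷_)
open import Data.Vec.Relation.Binary.Pointwise.Inductive using (Pointwise)
import Data.Vec.Relation.Binary.Pointwise.Inductive as PW
open import Data.List using (List; []; _∷_; _++_; map; filter; length)
open import Data.List.Membership.Propositional using (_∈_)
open import Data.List.Relation.Unary.Any using (Any; any?)
open import Data.Product using (Σ; _×_; _,_; ∃)
open import Relation.Nullary using (Dec; ¬_)
open import Relation.Nullary.Decidable using (_×-dec_)
open import Relation.Binary.PropositionalEquality using (_≡_)

Word : ℕ → Set
Word h = Vec Bool h

-- u ≤ v iff u_i ≤ v_i for all i (with 0 = false ≤ 1 = true).
_≤w_ : ∀ {h} → Word h → Word h → Set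
u ≤w v = Pointwise Bool._≤_ u v

_≤w?_ : ∀ {h} (u v : Word h) → Dec (u ≤w v)
u ≤w? v = PW.decidable BoolP._≤?_ u v

ham : ∀ {h} → Word h → Word h → ℕ
ham []       []       = 0
ham (a ∷ u) (b ∷ v) with a ≟ b
... | Relation.Nullary.yes _ = ham u v
... | Relation.Nullary.no  _ = suc (ham u v)

Adj : ∀ {h} → Word h → Word h → Set
Adj u v = ham u v ≡ 1

Adj? : ∀ {h} (u v : Word h) → Dec (Adj u v)
Adj? u v = ham u v ℕP.≟ 1

allWords : (h : ℕ) → List (Word h)
allWords zero    = [] ∷ []
allWords (suc h) = map (false ∷_) (allWords h) ++ map (true ∷_) (allWords h)

-- Vertex set of the daisy cube Q_h(X): words below some x ∈ X.
-- The finite set X ⊆ B^h is given as a list.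
InDaisy : ∀ {h} → List (Word h) → Word h → Set
InDaisy X v = Any (λ x → v ≤w x) X

InDaisy? : ∀ {h} (X : List (Word h)) (v : Word h) → Dec (InDaisy X v)
InDaisy? X v = any? (λ x → v ≤w? x) X

AdjG : ∀ {h} → List (Word h) → Word h → Word h → Set
AdjG X u v = InDaisy X u × InDaisy X v × Adj u v

degree : ∀ {h} → List (Word h) → Word h → ℕ
degree {h} X u =
  length (filter (λ w → InDaisy? X w ×-dec Adj? u w) (allWords h))

data Walk {h} (X : List (Word h)) : Word h → Word h → ℕ → Set where
  here  : ∀ {u} → InDaisy X u → Walk X u u 0
  step  : ∀ {u w v k} → AdjG X u w → Walk X w v k → Walk X u v (suc k)

IsDist : ∀ {h} → List (Word h) → Word h → Word h → ℕ → Set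
IsDist X u v d = Walk X u v d × (∀ k → k < d → ¬ Walk X u v k)

{-# OPTIONS --safe #-}
-- In a daisy cube G the graph distance is the Hamming distance: walking from a towards b one
-- can always step to a neighbour lying below a or below b, so the walk never leaves the
-- down-closed vertex set. The neighbours of v one step closer to u are therefore the words
-- obtained from v by flipping a coordinate where u and v differ, as long as they lie in G.
-- If u ∨ v ∈ G, all these d ≥ 2 flips lie below u ∨ v. Otherwise u ∨ v is at Hamming distance
-- at least 2 from u, because u ∨ v ≠ u and full degree h puts every hypercube neighbour of u
-- into G; at two such coordinates u is 0 and v is 1, and flipping them goes below v.
module Submission where

open import Defs
open import Data.Bool using (true; false; not; _∨_; f≤t; b≤b)
import Data.Bool as Bool
import Data.Bool.Properties as BoolP
open import Data.Bool.Properties using (not-¬)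
open import Data.Fin using (Fin; zero; suc)
import Data.Fin.Properties as FinP
open import Data.List using (List; []; _∷_; _++_; map; filter; length)
open import Data.List.Membership.Propositional using (_∈_)
open import Data.List.Properties using (filter-++; length-++; filter-none; length-filter)
open import Data.List.Relation.Unary.All using (universal)
open import Data.List.Relation.Unary.Any using (here; there)
import Data.List.Relation.Unary.Any as Any
import Data.List.Relation.Unary.Any.Properties as AnyP
open import Data.Nat using (ℕ; zero; suc; _+_; _∸_; _≤_; _<_; z≤n; s≤s)
open import Data.Nat.Properties
  using (≤-trans; ≤-reflexive; ≤-pred; ≤-antisym; <⇒≱; module ≤-Reasoning; <-≤-trans; <⇒≢; ≮⇒≥; +-mono-≤; +-comm; +-identityʳ; +-suc; n≤1+n; m≤n⇒m≤1+n; suc-injective)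
import Data.Product as Product
open import Data.Product using (Σ; ∃; ∃₂; _×_; _,_; proj₁; proj₂)
open import Data.Sum using (_⊎_; inj₁; inj₂)
import Data.Sum as Sum
open import Data.Vec using ([]; _∷_; lookup; zipWith; _[_]%=_)
open import Data.Vec.Properties using (∷-injectiveˡ; ∷-injectiveʳ; lookup-zipWith)
import Data.Vec.Relation.Binary.Pointwise.Inductive as PW
open import Data.Vec.Relation.Binary.Pointwise.Inductive using ([]; _∷_)
open import Function using (_∘_; id)
open import Relation.Nullary using (¬_; yes; no; does; contradiction)
open import Relation.Nullary.Decidable using (_×-dec_)
open import Relation.Unary using (Decidable)
open import Relation.Binary.PropositionalEquality
  using (_≡_; _≢_; refl; sym; trans; cong; cong₂; subst; module ≡-Reasoning)

ham-self≡0 : ∀ {h} (u : Word h) → ham u u ≡ 0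
ham-self≡0 []          = refl
ham-self≡0 (false ∷ u) = ham-self≡0 u
ham-self≡0 (true ∷ u)  = ham-self≡0 u

ham≡0⇒≡ : ∀ {h} {u v : Word h} → ham u v ≡ 0 → u ≡ v
ham≡0⇒≡ {u = []}        {[]}        _ = refl
ham≡0⇒≡ {u = false ∷ u} {false ∷ v} e = cong (false ∷_) (ham≡0⇒≡ e)
ham≡0⇒≡ {u = true ∷ u}  {true ∷ v}  e = cong (true ∷_) (ham≡0⇒≡ e)
ham≡0⇒≡ {u = false ∷ u} {true ∷ v}  ()
ham≡0⇒≡ {u = true ∷ u}  {false ∷ v} ()

ham-∷-≡ : ∀ {h} a {u v : Word h} → ham (a ∷ u) (a ∷ v) ≡ ham u v
ham-∷-≡ false = refl
ham-∷-≡ true  = refl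

ham-∷-not : ∀ {h} a {u v : Word h} → ham (a ∷ u) (not a ∷ v) ≡ suc (ham u v)
ham-∷-not false = refl
ham-∷-not true  = refl

ham-triangle : ∀ {h} (u v w : Word h) → ham u w ≤ ham u v + ham v w
ham-triangle [] [] [] = z≤n
ham-triangle (false ∷ u) (false ∷ v) (false ∷ w) = ham-triangle u v w
ham-triangle (true ∷ u)  (true ∷ v)  (true ∷ w)  = ham-triangle u v w
ham-triangle (false ∷ u) (true ∷ v)  (true ∷ w)  = s≤s (ham-triangle u v w)
ham-triangle (true ∷ u)  (false ∷ v) (false ∷ w) = s≤s (ham-triangle u v w)
ham-triangle (false ∷ u) (false ∷ v) (true ∷ w)  =
  subst (suc (ham u w) ≤_) (sym (+-suc (ham u v) (ham v w))) (s≤s (ham-triangle u v w))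
ham-triangle (true ∷ u)  (true ∷ v)  (false ∷ w) =
  subst (suc (ham u w) ≤_) (sym (+-suc (ham u v) (ham v w))) (s≤s (ham-triangle u v w))
ham-triangle (false ∷ u) (true ∷ v)  (false ∷ w) =
  ≤-trans (ham-triangle u v w) (+-mono-≤ (n≤1+n (ham u v)) (n≤1+n (ham v w)))
ham-triangle (true ∷ u)  (false ∷ v) (true ∷ w)  =
  ≤-trans (ham-triangle u v w) (+-mono-≤ (n≤1+n (ham u v)) (n≤1+n (ham v w)))

≤w-refl : ∀ {h} {u : Word h} → u ≤w u
≤w-refl = PW.refl BoolP.≤-refl

≤w-trans : ∀ {h} {u v w : Word h} → u ≤w v → v ≤w w → u ≤w w
≤w-trans = PW.trans BoolP.≤-trans

InDaisy-downward : ∀ {h} {X : List (Word h)} {v w} → InDaisy X v → w ≤w v → InDaisy X w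
InDaisy-downward v∈G w≤v = Any.map (≤w-trans w≤v) v∈G

closer-neighbour : ∀ {h n} (a b : Word h) → ham a b ≡ suc n →
                   Σ (Word h) λ a′ → Adj a a′ × ham a′ b ≡ n × (a′ ≤w a ⊎ a′ ≤w b)
closer-neighbour [] [] ()
closer-neighbour (true ∷ a) (false ∷ b) e =
  false ∷ a , cong suc (ham-self≡0 a) , suc-injective e , inj₁ (f≤t ∷ ≤w-refl)
closer-neighbour (false ∷ a) (true ∷ b) e with ham a b in a~b
... | zero with refl ← ham≡0⇒≡ {u = a} {b} a~b =
  true ∷ a , cong suc (ham-self≡0 a) , trans a~b (suc-injective e) , inj₂ ≤w-refl
... | suc m with a′ , adj , e′ , below ← closer-neighbour a b a~b =
  false ∷ a′ , adj , trans (cong suc e′) (suc-injective e) , Sum.map (b≤b ∷_) (f≤t ∷_) below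
closer-neighbour (false ∷ a) (false ∷ b) e with a′ , adj , e′ , below ← closer-neighbour a b e =
  false ∷ a′ , adj , e′ , Sum.map (b≤b ∷_) (b≤b ∷_) below
closer-neighbour (true ∷ a) (true ∷ b) e with a′ , adj , e′ , below ← closer-neighbour a b e =
  true ∷ a′ , adj , e′ , Sum.map (b≤b ∷_) (b≤b ∷_) below

module _ {h} (X : List (Word h)) where

  geodesic : ∀ n {a b} → ham a b ≡ n → InDaisy X a → InDaisy X b → Walk X a b n
  geodesic zero {a} {b} a~b a∈G _ with refl ← ham≡0⇒≡ {u = a} {b} a~b = here a∈G
  geodesic (suc n) {a} {b} a~b a∈G b∈G with a′ , adj , a′~b , below ← closer-neighbour a b a~b =
    step (a∈G , a′∈G , adj) (geodesic n a′~b a′∈G b∈G)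
    where
      a′∈G : InDaisy X a′
      a′∈G = Sum.[ InDaisy-downward a∈G , InDaisy-downward b∈G ] below

  ham≤walk-length : ∀ {a b k} → Walk X a b k → ham a b ≤ k
  ham≤walk-length {a} (here _) = subst (_≤ 0) (sym (ham-self≡0 a)) z≤n
  ham≤walk-length {a} {b} (step {w = w} (_ , _ , adj) walk) =
    ≤-trans (ham-triangle a w b) (subst (λ k → k + ham w b ≤ _) (sym adj) (s≤s (ham≤walk-length walk)))

  ham-IsDist : ∀ {a b} → InDaisy X a → InDaisy X b → IsDist X a b (ham a b)
  ham-IsDist a∈G b∈G = geodesic _ refl a∈G b∈G , λ _ k<ham walk → <⇒≱ k<ham (ham≤walk-length walk)

  IsDist⇒≡ham : ∀ {a b d} → InDaisy X a → InDaisy X b → IsDist X a b d → d ≡ ham a b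
  IsDist⇒≡ham a∈G b∈G (walk , shortest) =
    ≤-antisym (≮⇒≥ λ ham<d → shortest _ ham<d (geodesic _ refl a∈G b∈G)) (ham≤walk-length walk)

count : ∀ {A : Set} {P : A → Set} → Decidable P → List A → ℕ
count P? = length ∘ filter P?

module _ {A : Set} {P Q : A → Set} (P? : Decidable P) (Q? : Decidable Q) (Q⊆P : ∀ {x} → Q x → P x) where

  count-mono : ∀ xs → count Q? xs ≤ count P? xs
  count-mono [] = z≤n
  count-mono (x ∷ xs) with Q? x | P? x
  ... | yes qx | no ¬px = contradiction (Q⊆P qx) ¬px
  ... | yes _  | yes _  = s≤s (count-mono xs)
  ... | no _   | yes _  = m≤n⇒m≤1+n (count-mono xs)
  ... | no _   | no _   = count-mono xs

  count-strict-mono : ∀ {x xs} → x ∈ xs → P x → ¬ Q x → count Q? xs < count P? xs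
  count-strict-mono {xs = y ∷ ys} (here refl) px ¬qx with Q? y | P? y
  ... | yes qx | _      = contradiction qx ¬qx
  ... | no _   | yes _  = s≤s (count-mono ys)
  ... | no _   | no ¬px = contradiction px ¬px
  count-strict-mono {xs = y ∷ ys} (there x∈ys) px ¬qx with Q? y | P? y
  ... | yes qy | no ¬py = contradiction (Q⊆P qy) ¬py
  ... | yes _  | yes _  = s≤s (count-strict-mono x∈ys px ¬qx)
  ... | no _   | yes _  = m≤n⇒m≤1+n (count-strict-mono x∈ys px ¬qx)
  ... | no _   | no _   = count-strict-mono x∈ys px ¬qx

count-map : ∀ {A B : Set} {P : A → Set} (P? : Decidable P) (f : B → A) xs →
            count P? (map f xs) ≡ count (P? ∘ f) xs
count-map P? f [] = refl
count-map P? f (x ∷ xs) with does (P? (f x))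
... | true  = cong suc (count-map P? f xs)
... | false = count-map P? f xs

count-none : ∀ {A : Set} {P : A → Set} (P? : Decidable P) → (∀ x → ¬ P x) → ∀ xs → count P? xs ≡ 0
count-none P? ¬P xs = cong length (filter-none P? (universal ¬P xs))

allWords-complete : ∀ {h} (w : Word h) → w ∈ allWords h
allWords-complete [] = here refl
allWords-complete (false ∷ w) = AnyP.++⁺ˡ (AnyP.map⁺ (Any.map (cong (false ∷_)) (allWords-complete w)))
allWords-complete (true ∷ w)  = AnyP.++⁺ʳ _ (AnyP.map⁺ (Any.map (cong (true ∷_)) (allWords-complete w)))

count-allWords-suc : ∀ {h} {Q : Word (suc h) → Set} (Q? : Decidable Q) a →
                     count Q? (allWords (suc h)) ≡
                     count (Q? ∘ (a ∷_)) (allWords h) + count (Q? ∘ (not a ∷_)) (allWords h)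
count-allWords-suc {h} Q? false = begin
  count Q? (map (false ∷_) (allWords h) ++ map (true ∷_) (allWords h))
    ≡⟨ cong length (filter-++ Q? (map (false ∷_) (allWords h)) _) ⟩
  length (filter Q? (map (false ∷_) (allWords h)) ++ filter Q? (map (true ∷_) (allWords h)))
    ≡⟨ length-++ (filter Q? (map (false ∷_) (allWords h))) ⟩
  count Q? (map (false ∷_) (allWords h)) + count Q? (map (true ∷_) (allWords h))
    ≡⟨ cong₂ _+_ (count-map Q? (false ∷_) (allWords h)) (count-map Q? (true ∷_) (allWords h)) ⟩
  count (Q? ∘ (false ∷_)) (allWords h) + count (Q? ∘ (true ∷_)) (allWords h) ∎
  where open ≡-Reasoning
count-allWords-suc {h} Q? true =
  trans (count-allWords-suc Q? false) (+-comm (count (Q? ∘ (false ∷_)) (allWords h)) _)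

count-singleton-≤1 : ∀ {h} {Q : Word h → Set} (Q? : Decidable Q) u →
                     (∀ {w} → Q w → w ≡ u) → count Q? (allWords h) ≤ 1
count-singleton-≤1 {zero} Q? _ _ = length-filter Q? (allWords zero)
count-singleton-≤1 {suc h} {Q} Q? (a ∷ u) Q⇒≡ = begin
  count Q? (allWords (suc h))
    ≡⟨ count-allWords-suc Q? a ⟩
  count (Q? ∘ (a ∷_)) (allWords h) + count (Q? ∘ (not a ∷_)) (allWords h)
    ≡⟨ cong (count (Q? ∘ (a ∷_)) (allWords h) +_) (count-none (Q? ∘ (not a ∷_)) ¬Q-not (allWords h)) ⟩
  count (Q? ∘ (a ∷_)) (allWords h) + 0
    ≡⟨ +-identityʳ _ ⟩
  count (Q? ∘ (a ∷_)) (allWords h)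
    ≤⟨ count-singleton-≤1 (Q? ∘ (a ∷_)) u (∷-injectiveʳ ∘ Q⇒≡) ⟩
  1 ∎
  where
    open ≤-Reasoning
    ¬Q-not : ∀ w → ¬ Q (not a ∷ w)
    ¬Q-not w q = not-¬ refl (sym (∷-injectiveˡ (Q⇒≡ q)))

count-sphere-≤ : ∀ {h} {Q : Word h → Set} (Q? : Decidable Q) u →
                 (∀ {w} → Q w → Adj u w) → count Q? (allWords h) ≤ h
count-sphere-≤ {zero} Q? [] Q⇒adj =
  ≤-reflexive (count-none Q? (λ { [] q → contradiction (Q⇒adj q) λ () }) (allWords zero))
count-sphere-≤ {suc h} Q? (a ∷ u) Q⇒adj = begin
  count Q? (allWords (suc h))
    ≡⟨ count-allWords-suc Q? a ⟩
  count (Q? ∘ (a ∷_)) (allWords h) + count (Q? ∘ (not a ∷_)) (allWords h)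
    ≤⟨ +-mono-≤ (count-sphere-≤ (Q? ∘ (a ∷_)) u (trans (sym (ham-∷-≡ a)) ∘ Q⇒adj))
                (count-singleton-≤1 (Q? ∘ (not a ∷_)) u (sym ∘ ham≡0⇒≡ ∘ suc-injective ∘ trans (sym (ham-∷-not a)) ∘ Q⇒adj)) ⟩
  h + 1
    ≡⟨ +-comm h 1 ⟩
  suc h ∎
  where open ≤-Reasoning

degree≡h⇒Adj⇒InDaisy : ∀ {h} (X : List (Word h)) u {w} → degree X u ≡ h → Adj u w → InDaisy X w
degree≡h⇒Adj⇒InDaisy {h} X u {w} deg adj with InDaisy? X w
... | yes w∈G = w∈G
... | no w∉G = contradiction deg (<⇒≢ (<-≤-trans
      (count-strict-mono (Adj? u) (λ x → InDaisy? X x ×-dec Adj? u x) proj₂ (allWords-complete w) adj (w∉G ∘ proj₁))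
      (count-sphere-≤ (Adj? u) u id)))

≤-∨ʳ : ∀ x y → y Bool.≤ x ∨ y
≤-∨ʳ false y     = BoolP.≤-refl
≤-∨ʳ true  false = f≤t
≤-∨ʳ true  true  = b≤b

≤w-∨ʳ : ∀ {h} (u v : Word h) → v ≤w zipWith _∨_ u v
≤w-∨ʳ []      []      = []
≤w-∨ʳ (x ∷ u) (y ∷ v) = ≤-∨ʳ x y ∷ ≤w-∨ʳ u v

Differ : ∀ {h} → Word h → Word h → Fin h → Set
Differ u v i = lookup u i ≢ lookup v i

Differ-∨ : ∀ {h} (u v : Word h) i → Differ u (zipWith _∨_ u v) i → Differ u v i × lookup v i ≡ true
Differ-∨ u v i differ rewrite lookup-zipWith _∨_ i u v = bit (lookup u i) (lookup v i) differ
  where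
    bit : ∀ x y → x ≢ x ∨ y → x ≢ y × y ≡ true
    bit false false ≢ = contradiction refl ≢
    bit false true  _ = (λ ()) , refl
    bit true  y     ≢ = contradiction refl ≢

ham-flip : ∀ {h} (v : Word h) i → Adj v (v [ i ]%= not)
ham-flip (false ∷ v) zero    = cong suc (ham-self≡0 v)
ham-flip (true ∷ v)  zero    = cong suc (ham-self≡0 v)
ham-flip (x ∷ v)     (suc i) = trans (ham-∷-≡ x) (ham-flip v i)

ham-flip-Differ : ∀ {h} (u v : Word h) i → Differ u v i → suc (ham u (v [ i ]%= not)) ≡ ham u v
ham-flip-Differ (false ∷ u) (false ∷ v) zero    differ = contradiction refl differ
ham-flip-Differ (true ∷ u)  (true ∷ v)  zero    differ = contradiction refl differ
ham-flip-Differ (false ∷ u) (true ∷ v)  zero    _      = refl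
ham-flip-Differ (true ∷ u)  (false ∷ v) zero    _      = refl
ham-flip-Differ (false ∷ u) (false ∷ v) (suc i) differ = ham-flip-Differ u v i differ
ham-flip-Differ (true ∷ u)  (true ∷ v)  (suc i) differ = ham-flip-Differ u v i differ
ham-flip-Differ (false ∷ u) (true ∷ v)  (suc i) differ = cong suc (ham-flip-Differ u v i differ)
ham-flip-Differ (true ∷ u)  (false ∷ v) (suc i) differ = cong suc (ham-flip-Differ u v i differ)

flip-injective : ∀ {h} (v : Word h) {i j} → v [ i ]%= not ≡ v [ j ]%= not → i ≡ j
flip-injective (x ∷ v) {zero}  {zero}  _ = refl
flip-injective (x ∷ v) {zero}  {suc j} e = contradiction (sym (∷-injectiveˡ e)) (not-¬ refl)
flip-injective (x ∷ v) {suc i} {zero}  e = contradiction (∷-injectiveˡ e) (not-¬ refl)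
flip-injective (x ∷ v) {suc i} {suc j} e = cong suc (flip-injective v (∷-injectiveʳ e))

flip-≤-self : ∀ {h} (v : Word h) i → lookup v i ≡ true → (v [ i ]%= not) ≤w v
flip-≤-self (true ∷ v) zero    _ = f≤t ∷ ≤w-refl
flip-≤-self (x ∷ v)    (suc i) e = BoolP.≤-refl ∷ flip-≤-self v i e

flip-≤-∨ : ∀ {h} (u v : Word h) i → Differ u v i → (v [ i ]%= not) ≤w zipWith _∨_ u v
flip-≤-∨ (false ∷ u) (false ∷ v) zero    differ = contradiction refl differ
flip-≤-∨ (true ∷ u)  (true ∷ v)  zero    differ = contradiction refl differ
flip-≤-∨ (false ∷ u) (true ∷ v)  zero    _      = f≤t ∷ ≤w-∨ʳ u v
flip-≤-∨ (true ∷ u)  (false ∷ v) zero    _      = b≤b ∷ ≤w-∨ʳ u v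
flip-≤-∨ (x ∷ u)     (y ∷ v)     (suc i) differ = ≤-∨ʳ x y ∷ flip-≤-∨ u v i differ

TwoDistinct : ∀ {h} → (Fin h → Set) → Set
TwoDistinct P = ∃₂ λ i j → i ≢ j × P i × P j

TwoDistinct-map : ∀ {h} {P Q : Fin h → Set} → (∀ {i} → P i → Q i) → TwoDistinct P → TwoDistinct Q
TwoDistinct-map f (i , j , i≢j , pi , pj) = i , j , i≢j , f pi , f pj

TwoDistinct-suc : ∀ {h} {P : Fin (suc h) → Set} → TwoDistinct (P ∘ suc) → TwoDistinct P
TwoDistinct-suc (i , j , i≢j , pi , pj) = suc i , suc j , i≢j ∘ FinP.suc-injective , pi , pj

differing-coordinate : ∀ {h} (u v : Word h) → 1 ≤ ham u v → ∃ (Differ u v)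
differing-coordinate [] [] ()
differing-coordinate (false ∷ u) (false ∷ v) p = Product.map suc id (differing-coordinate u v p)
differing-coordinate (true ∷ u)  (true ∷ v)  p = Product.map suc id (differing-coordinate u v p)
differing-coordinate (false ∷ u) (true ∷ v)  _ = zero , λ ()
differing-coordinate (true ∷ u)  (false ∷ v) _ = zero , λ ()

two-differing-coordinates : ∀ {h} (u v : Word h) → 2 ≤ ham u v → TwoDistinct (Differ u v)
two-differing-coordinates [] [] ()
two-differing-coordinates (false ∷ u) (false ∷ v) p = TwoDistinct-suc (two-differing-coordinates u v p)
two-differing-coordinates (true ∷ u)  (true ∷ v)  p = TwoDistinct-suc (two-differing-coordinates u v p)
two-differing-coordinates (false ∷ u) (true ∷ v)  p with j , differ ← differing-coordinate u v (≤-pred p) =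
  zero , suc j , (λ ()) , (λ ()) , differ
two-differing-coordinates (true ∷ u)  (false ∷ v) p with j , differ ← differing-coordinate u v (≤-pred p) =
  zero , suc j , (λ ()) , (λ ()) , differ

2≤ham : ∀ {h} {u v : Word h} → u ≢ v → ¬ Adj u v → 2 ≤ ham u v
2≤ham {u = u} {v} u≢v ¬adj with ham u v in u~v
... | zero        = contradiction (ham≡0⇒≡ {u = u} {v} u~v) u≢v
... | suc zero    = contradiction refl ¬adj
... | suc (suc _) = s≤s (s≤s z≤n)

module _ {h} (X : List (Word h)) {u v : Word h} (u∈G : InDaisy X u) (v∈G : InDaisy X v) where

  Closer : Fin h → Set
  Closer i = Differ u v i × InDaisy X (v [ i ]%= not)

  two-closer-coordinates : degree X u ≡ h → u ≢ v → ¬ Adj u v → TwoDistinct Closer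
  two-closer-coordinates deg u≢v ¬adj with InDaisy? X (zipWith _∨_ u v)
  ... | yes u∨v∈G =
    TwoDistinct-map (λ {i} differ → differ , InDaisy-downward u∨v∈G (flip-≤-∨ u v i differ))
      (two-differing-coordinates u v (2≤ham u≢v ¬adj))
  ... | no u∨v∉G =
    TwoDistinct-map (λ {i} differ → Product.map id (InDaisy-downward v∈G ∘ flip-≤-self v i) (Differ-∨ u v i differ))
      (two-differing-coordinates u (zipWith _∨_ u v)
        (2≤ham (λ u≡u∨v → u∨v∉G (subst (InDaisy X) u≡u∨v u∈G)) (u∨v∉G ∘ degree≡h⇒Adj⇒InDaisy X u deg)))

  Closer⇒geodesic-neighbour : ∀ {i} → Closer i →
    AdjG X v (v [ i ]%= not) × IsDist X u (v [ i ]%= not) (ham u v ∸ 1)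
  Closer⇒geodesic-neighbour {i} (differ , z∈G) =
    (v∈G , z∈G , ham-flip v i) ,
    subst (IsDist X u _) (cong (_∸ 1) (ham-flip-Differ u v i differ)) (ham-IsDist X u∈G z∈G)

lemma4 : (h : ℕ) (X : List (Word h)) (u : Word h) →
         InDaisy X u → degree X u ≡ h →
         (v : Word h) → InDaisy X v → ¬ (v ≡ u) → ¬ AdjG X u v →
         (d : ℕ) → IsDist X u v d →
         Σ (Word h) λ z₁ → Σ (Word h) λ z₂ →
           ¬ (z₁ ≡ z₂) ×
           AdjG X v z₁ × IsDist X u z₁ (d ∸ 1) ×
           AdjG X v z₂ × IsDist X u z₂ (d ∸ 1)
lemma4 h X u u∈G deg v v∈G v≢u ¬adjG d dist
  rewrite IsDist⇒≡ham X u∈G v∈G dist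
  with i , j , i≢j , closer-i , closer-j ←
         two-closer-coordinates X u∈G v∈G deg (v≢u ∘ sym) (λ adj → ¬adjG (u∈G , v∈G , adj))
  = let adj-i , dist-i = Closer⇒geodesic-neighbour X u∈G v∈G closer-i
        adj-j , dist-j = Closer⇒geodesic-neighbour X u∈G v∈G closer-j
    in v [ i ]%= not , v [ j ]%= not , i≢j ∘ flip-injective v , adj-i , dist-i , adj-j , dist-j
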